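{- If $G$ is a simple connected graph of diameter at most $2$ that is not a path, then $md(G)=\infty$.
   Context: For vertices $u,v$ of a connected graph $G$, $d(u,v)$ is the length of a shortest $u$–$v$ path. For $W\subseteq V(G)$ and $v\in V(G)$, $r_m(v|W)$ is the multiset $\{d(v,w): w\in W\}$. $W$ is an m-resolving set if $r_m(u|W)\neq r_m(v|W)$ for all distinct $u,v\in V(G)$. If $G$ has an m-resolving set, $md(G)$ is the minimum cardinality of one; otherwise $md(G)=\infty$. -}

module Defs where

open import Data.Nat using (ℕ; zero; suc; _≤_)
open import Data.Bool using (Bool; true; false; _∧_; _∨_; if_then_else_)
open import Data.Fin using (Fin; toℕ; _≟_)
open import Data.Fin.Subset using (Subset)
open import Data.List using (List; map; filterᵇ)
open import Data.Bool.ListAction using (any)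
open import Data.Vec using (lookup)
open import Data.List.Relation.Binary.Permutation.Propositional using (_↭_)
open import Data.Product using (Σ; ∃; _×_)
open import Data.Sum using (_⊎_)
open import Function.Definitions using (Bijective)
open import Function.Bundles using (_⇔_)
open import Relation.Binary.PropositionalEquality using (_≡_; _≢_)
open import Relation.Nullary using (¬_; does)
import Data.List as L

allFin : (n : ℕ) → List (Fin n)
allFin n = L.allFin n

record SimpleGraph (n : ℕ) : Set where
  field
    adj    : Fin n → Fin n → Bool
    symm   : ∀ u v → adj u v ≡ adj v u
    irrefl : ∀ u → adj u u ≡ false

module _ {n : ℕ} (G : SimpleGraph n) where
  open SimpleGraph G

  reach : ℕ → Fin n → Fin n → Bool
  reach zero    u v = does (u ≟ v)
  reach (suc k) u v = reach k u v ∨ any (λ w → adj u w ∧ reach k w v) (allFin n)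

  private
    search : Fin n → Fin n → ℕ → ℕ → ℕ
    search u v k zero    = k
    search u v k (suc f) = if reach k u v then k else search u v (suc k) f

  -- d(u,v): length of a shortest u–v path (the least k with a walk of
  -- length ≤ k); in a connected graph on n vertices this is < n, so the
  -- search over k = 0..n is exhaustive.
  dist : Fin n → Fin n → ℕ
  dist u v = search u v 0 n

  Connected : Set
  Connected = ∀ u v → Σ ℕ (λ k → reach k u v ≡ true)

  DiamAtMost2 : Set
  DiamAtMost2 = ∀ u v → dist u v ≤ 2

  IsPath : Set
  IsPath = Σ (Fin n → Fin n) λ f → Bijective _≡_ _≡_ f ×
             (∀ u v → (adj u v ≡ true) ⇔
                      (toℕ (f u) ≡ suc (toℕ (f v)) ⊎ toℕ (f v) ≡ suc (toℕ (f u))))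

  elems : Subset n → List (Fin n)
  elems W = filterᵇ (λ w → lookup W w) (allFin n)

  -- r_m(v|W) = multiset {d(v,w) : w ∈ W}, as a list up to permutation.
  rm : Fin n → Subset n → List ℕ
  rm v W = map (dist v) (elems W)

  MResolving : Subset n → Set
  MResolving W = ∀ u v → u ≢ v → ¬ (rm u W ↭ rm v W)

  MdInfinite : Set
  MdInfinite = ∀ W → ¬ MResolving W

module Submission where

-- In diameter ≤ 2 every distance is 0, 1 or 2, so the multiset r_m(v|W) is
-- determined by |W|, by whether v ∈ W, and by the number of neighbours of v
-- in W (its W-degree).  Let W be any vertex set.
--   * |W| = 0: all multisets are empty.
--   * |W| = 1, W = {w}: two vertices at the same distance from w collide.  With
--     at least four vertices they exist by pigeonhole on {0,1,2}; a connected
--     non-path on three vertices is a triangle, where the two vertices other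
--     than w are both at distance 1.
--   * |W| ≥ 2: every vertex of W has exactly one distance 0 to W, and the
--     graph induced on W has two vertices of equal degree (the classical
--     degree pigeonhole); these two vertices collide.
-- Connected graphs on at most two vertices are paths, which settles n ≤ 2.

open import Defs
open import Data.Bool using (Bool; true; false; _∧_; _∨_; if_then_else_)
import Data.Bool as Bool
open import Data.Bool.ListAction using (any)
open import Data.Bool.Properties using (T-≡; T-∨; ∨-zeroʳ; ¬-not)
open import Data.Empty using (⊥; ⊥-elim)
open import Data.Fin using (Fin; zero; suc; toℕ; fromℕ<; _≟_)
open import Data.Fin.Patterns using (0F; 1F; 2F)
open import Data.Fin.Permutation using (Permutation′; _⟨$⟩ʳ_; transpose)
import Data.Fin.Permutation as Perm
open import Data.Fin.Properties using (pigeonhole; any?; all?; fromℕ<-injective) renaming (<⇒≢ to <⇒≢ᶠ)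
open import Data.List using (List; []; _∷_; map; length; _++_; replicate; lookup)
open import Data.List.Membership.Propositional using (_∈_; find; lose)
open import Data.List.Membership.Propositional.Properties using (∈-allFin; ∈-lookup)
open import Data.List.Properties using (length-map)
open import Data.List.Relation.Binary.Permutation.Propositional using (_↭_; prep; ↭-sym; ↭-trans; ↭-reflexive)
import Data.List.Relation.Binary.Permutation.Propositional as ↭
open import Data.List.Relation.Binary.Permutation.Propositional.Properties using (shift; ++⁺ˡ)
open import Data.List.Relation.Unary.All using (All; []; _∷_; universal)
import Data.List.Relation.Unary.All as All
open import Data.List.Relation.Unary.All.Properties using (map⁺)
open import Data.List.Relation.Unary.AllPairs using ([]; _∷_)
open import Data.List.Relation.Unary.Any using (here; there)
open import Data.List.Relation.Unary.Any.Properties using (any⁺; any⁻)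
open import Data.List.Relation.Unary.Unique.Propositional using (Unique)
open import Data.List.Relation.Unary.Unique.Propositional.Properties using (filter⁺; allFin⁺)
open import Data.Nat using (ℕ; zero; suc; pred; ≢-nonZero; _≤_; _<_; z≤n; s≤s; s≤s⁻¹; _+_; _≡ᵇ_)
open import Data.Nat.Properties using (pred-injective; ≡ᵇ⇒≡; ≡⇒≡ᵇ; +-suc; +-cancelˡ-≡; m≤n⇒m≤1+n; n<1+n; ≤∧≢⇒<; 0≢1+n; 1+n≰n)
open import Data.Product using (∃; ∃₂; _×_; _,_)
open import Data.Sum using (_⊎_; inj₁; inj₂; [_,_]′)
import Data.Sum as Sum
import Data.Nat as ℕ
import Data.Vec as Vec
open import Function using (_∘_)
open import Function.Bundles using (_⇔_; mk⇔; Equivalence; Bijection)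
open import Function.Properties.Inverse using (Inverse⇒Bijection)
open import Relation.Binary.Definitions using (DecidableEquality)
open import Relation.Binary.PropositionalEquality using (_≡_; _≢_; refl; sym; trans; cong; cong₂; subst; module ≡-Reasoning)
open import Relation.Nullary using (¬_; Dec; does; yes; no)
open import Relation.Nullary.Decidable using (True; toWitness; dec-true; dec-false; T?)

open Equivalence using (to; from)

any-witness : ∀ {A : Set} (p : A → Bool) xs → any p xs ≡ true → ∃ λ x → x ∈ xs × p x ≡ true
any-witness p xs found with x , x∈xs , px ← find (any⁻ p xs (from T-≡ found)) = x , x∈xs , to T-≡ px

any-intro : ∀ {A : Set} (p : A → Bool) {x xs} → x ∈ xs → p x ≡ true → any p xs ≡ true
any-intro p x∈xs px = to T-≡ (any⁺ p (lose x∈xs (from T-≡ px)))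

∧-true : ∀ {a b} → a ∧ b ≡ true → a ≡ true × b ≡ true
∧-true {true} b≡true = refl , b≡true

count : ∀ {A : Set} → (A → Bool) → List A → ℕ
count p []       = 0
count p (x ∷ xs) = if p x then suc (count p xs) else count p xs

count-cong : ∀ {A : Set} {p q : A → Bool} → (∀ x → p x ≡ q x) → ∀ xs → count p xs ≡ count q xs
count-cong p≗q []       = refl
count-cong {q = q} p≗q (x ∷ xs) rewrite p≗q x with q x
... | true  = cong suc (count-cong p≗q xs)
... | false = count-cong p≗q xs

count-map : ∀ {A B : Set} (p : B → Bool) (f : A → B) xs → count p (map f xs) ≡ count (p ∘ f) xs
count-map p f []       = refl
count-map p f (x ∷ xs) with p (f x)
... | true  = cong suc (count-map p f xs)
... | false = count-map p f xs

count≤length : ∀ {A : Set} (p : A → Bool) xs → count p xs ≤ length xs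
count≤length p []       = z≤n
count≤length p (x ∷ xs) with p x
... | true  = s≤s (count≤length p xs)
... | false = m≤n⇒m≤1+n (count≤length p xs)

count<length : ∀ {A : Set} (p : A → Bool) {x} xs → x ∈ xs → p x ≡ false → count p xs < length xs
count<length p (y ∷ ys) (here refl) px rewrite px = s≤s (count≤length p ys)
count<length p (y ∷ ys) (there x∈ys) px with p y
... | true  = s≤s (count<length p ys x∈ys px)
... | false = m≤n⇒m≤1+n (count<length p ys x∈ys px)

count+2≤length : ∀ {A : Set} (p : A → Bool) {x y} xs → x ∈ xs → y ∈ xs → x ≢ y →
                 p x ≡ false → p y ≡ false → 2 + count p xs ≤ length xs
count+2≤length p (z ∷ zs) (here refl) (here refl) x≢y px py = ⊥-elim (x≢y refl)
count+2≤length p (z ∷ zs) (here refl) (there y∈zs) x≢y px py rewrite px = s≤s (count<length p zs y∈zs py)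
count+2≤length p (z ∷ zs) (there x∈zs) (here refl) x≢y px py rewrite py = s≤s (count<length p zs x∈zs px)
count+2≤length p (z ∷ zs) (there x∈zs) (there y∈zs) x≢y px py with p z
... | true  = s≤s (count+2≤length p zs x∈zs y∈zs x≢y px py)
... | false = m≤n⇒m≤1+n (count+2≤length p zs x∈zs y∈zs x≢y px py)

count≡0 : ∀ {A : Set} (p : A → Bool) {x} xs → count p xs ≡ 0 → x ∈ xs → p x ≡ false
count≡0 p (y ∷ ys) c≡0 x∈xs with p y in py
count≡0 p (y ∷ ys) c≡0 (here refl)  | false = py
count≡0 p (y ∷ ys) c≡0 (there x∈ys) | false = count≡0 p ys c≡0 x∈ys

module _ {A : Set} (_≟ᴬ_ : DecidableEquality A) where

  count-absent : ∀ u xs → All (u ≢_) xs → count (λ x → does (u ≟ᴬ x)) xs ≡ 0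
  count-absent u []       []             = refl
  count-absent u (x ∷ xs) (u≢x ∷ u∉xs) rewrite dec-false (u ≟ᴬ x) u≢x = count-absent u xs u∉xs

  count-member : ∀ u xs → Unique xs → u ∈ xs → count (λ x → does (u ≟ᴬ x)) xs ≡ 1
  count-member u (x ∷ xs) (u∉xs ∷ _) (here refl) rewrite dec-true (u ≟ᴬ u) refl =
    cong suc (count-absent u xs u∉xs)
  count-member u (x ∷ xs) (x∉xs ∷ xs!) (there u∈xs)
    rewrite dec-false (u ≟ᴬ x) (λ { refl → All.lookup x∉xs u∈xs refl }) = count-member u xs xs! u∈xs

lookup-injective : ∀ {A : Set} (xs : List A) → Unique xs → ∀ i j → lookup xs i ≡ lookup xs j → i ≡ j
lookup-injective (x ∷ xs) xs!          zero    zero    _ = refl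
lookup-injective (x ∷ xs) (x∉xs ∷ _)   zero    (suc j) e = ⊥-elim (All.lookup x∉xs (∈-lookup j) e)
lookup-injective (x ∷ xs) (x∉xs ∷ _)   (suc i) zero    e = ⊥-elim (All.lookup x∉xs (∈-lookup i) (sym e))
lookup-injective (x ∷ xs) (_ ∷ xs!)    (suc i) (suc j) e = cong suc (lookup-injective xs xs! i j e)

occ : ℕ → List ℕ → ℕ
occ k = count (_≡ᵇ k)

sorted₀₁₂ : ℕ → ℕ → ℕ → List ℕ
sorted₀₁₂ a b c = replicate a 0 ++ replicate b 1 ++ replicate c 2

↭-sorted : ∀ ys → All (_≤ 2) ys → ys ↭ sorted₀₁₂ (occ 0 ys) (occ 1 ys) (occ 2 ys)
↭-sorted []       []                    = ↭.refl
↭-sorted (0 ∷ ys) (_ ∷ ys≤2)            = prep 0 (↭-sorted ys ys≤2)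
↭-sorted (1 ∷ ys) (_ ∷ ys≤2)            =
  ↭-trans (prep 1 (↭-sorted ys ys≤2)) (↭-sym (shift 1 zeros (ones ++ twos)))
  where zeros = replicate (occ 0 ys) 0
        ones  = replicate (occ 1 ys) 1
        twos  = replicate (occ 2 ys) 2
↭-sorted (2 ∷ ys) (_ ∷ ys≤2)            =
  ↭-trans (prep 2 (↭-sorted ys ys≤2))
    (↭-trans (↭-sym (shift 2 zeros (ones ++ twos))) (++⁺ˡ zeros (↭-sym (shift 2 ones twos))))
  where zeros = replicate (occ 0 ys) 0
        ones  = replicate (occ 1 ys) 1
        twos  = replicate (occ 2 ys) 2
↭-sorted (suc (suc (suc _)) ∷ _) (s≤s (s≤s ()) ∷ _)

occ-length : ∀ ys → All (_≤ 2) ys → occ 0 ys + occ 1 ys + occ 2 ys ≡ length ys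
occ-length []       []         = refl
occ-length (0 ∷ ys) (_ ∷ ys≤2) = cong suc (occ-length ys ys≤2)
occ-length (1 ∷ ys) (_ ∷ ys≤2) =
  trans (cong (_+ occ 2 ys) (+-suc (occ 0 ys) (occ 1 ys))) (cong suc (occ-length ys ys≤2))
occ-length (2 ∷ ys) (_ ∷ ys≤2) =
  trans (+-suc (occ 0 ys + occ 1 ys) (occ 2 ys)) (cong suc (occ-length ys ys≤2))
occ-length (suc (suc (suc _)) ∷ _) (s≤s (s≤s ()) ∷ _)

↭-by-occurrences : ∀ ys zs → All (_≤ 2) ys → All (_≤ 2) zs → length ys ≡ length zs →
                   occ 0 ys ≡ occ 0 zs → occ 1 ys ≡ occ 1 zs → ys ↭ zs
↭-by-occurrences ys zs ys≤2 zs≤2 |ys|≡|zs| zeros ones =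
  ↭-trans (↭-sorted ys ys≤2)
    (↭-trans (↭-reflexive (cong₂ (λ a b → sorted₀₁₂ a b (occ 2 ys)) zeros ones))
      (↭-trans (↭-reflexive (cong (sorted₀₁₂ (occ 0 zs) (occ 1 zs)) twos)) (↭-sym (↭-sorted zs zs≤2))))
  where
    twos : occ 2 ys ≡ occ 2 zs
    twos = +-cancelˡ-≡ (occ 0 zs + occ 1 zs) _ _ (begin
      occ 0 zs + occ 1 zs + occ 2 ys ≡⟨ cong₂ (λ a b → a + b + occ 2 ys) zeros ones ⟨
      occ 0 ys + occ 1 ys + occ 2 ys ≡⟨ occ-length ys ys≤2 ⟩
      length ys                      ≡⟨ |ys|≡|zs| ⟩
      length zs                      ≡⟨ occ-length zs zs≤2 ⟨
      occ 0 zs + occ 1 zs + occ 2 zs ∎)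
      where open ≡-Reasoning

coded-collision : ∀ k (d : Fin (2 + k) → ℕ) (c : Fin (2 + k) → Fin (suc k)) →
                  (∀ i j → c i ≡ c j → d i ≡ d j) → ∃₂ λ i j → i ≢ j × d i ≡ d j
coded-collision k d c c-faithful with i , j , i<j , ci≡cj ← pigeonhole (n<1+n (suc k)) c =
  i , j , <⇒≢ᶠ i<j , c-faithful i j ci≡cj

repeated-value : ∀ k (d : Fin (2 + k) → ℕ) → (∀ i → d i ≤ suc k) →
                 (∀ i → d i ≢ 0) ⊎ (∀ i → d i ≢ suc k) → ∃₂ λ i j → i ≢ j × d i ≡ d j
repeated-value k d d≤ (inj₁ d≢0) = coded-collision k d (λ i → fromℕ< (code< i)) faithful
  where
    -- a nonzero value m is encoded as m - 1
    pred< : ∀ m → m ≢ 0 → m ≤ suc k → pred m < suc k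
    pred< zero    m≢0 _         = ⊥-elim (m≢0 refl)
    pred< (suc m) _   (s≤s m≤k) = s≤s m≤k
    code< : ∀ i → pred (d i) < suc k
    code< i = pred< (d i) (d≢0 i) (d≤ i)
    faithful : ∀ i j → fromℕ< (code< i) ≡ fromℕ< (code< j) → d i ≡ d j
    faithful i j same = pred-injective {{≢-nonZero (d≢0 i)}} {{≢-nonZero (d≢0 j)}}
                          (fromℕ<-injective _ _ (code< i) (code< j) same)
repeated-value k d d≤ (inj₂ d≢top) = coded-collision k d (λ i → fromℕ< (code< i)) faithful
  where
    -- a value below the top is its own code
    code< : ∀ i → d i < suc k
    code< i = ≤∧≢⇒< (d≤ i) (d≢top i)
    faithful : ∀ i j → fromℕ< (code< i) ≡ fromℕ< (code< j) → d i ≡ d j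
    faithful i j = fromℕ<-injective _ _ (code< i) (code< j)

-- The graph is given by a symmetric
-- irreflexive boolean relation R on the vertices of a duplicate-free list xs,
-- and the degree of x is count (R x) xs.
equal-degrees : ∀ {A : Set} (R : A → A → Bool) → (∀ x y → R x y ≡ R y x) → (∀ x → R x x ≡ false) →
                ∀ xs → Unique xs → 2 ≤ length xs →
                ∃₂ λ x y → x ∈ xs × y ∈ xs × x ≢ y × count (R x) xs ≡ count (R y) xs
equal-degrees R R-sym R-irrefl (_ ∷ []) _ (s≤s ())
equal-degrees R R-sym R-irrefl xs@(_ ∷ _ ∷ zs) xs! _ =
  as-vertices (repeated-value (length zs) deg deg≤ misses-an-end)
  where
    vertex : Fin (length xs) → _
    vertex = lookup xs
    deg : Fin (length xs) → ℕ
    deg i = count (R (vertex i)) xs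
    -- no vertex is its own neighbour
    deg≤ : ∀ i → deg i ≤ suc (length zs)
    deg≤ i = s≤s⁻¹ (count<length (R (vertex i)) xs (∈-lookup i) (R-irrefl (vertex i)))
    -- a vertex of degree 0 and a vertex adjacent to all others cannot coexist
    no-full : ∀ a → deg a ≡ 0 → ∀ i → deg i ≢ suc (length zs)
    no-full a deg-a≡0 i deg-i≡top with i ≟ a
    ... | yes refl = 0≢1+n (trans (sym deg-a≡0) deg-i≡top)
    ... | no i≢a   = 1+n≰n (subst (λ d → 2 + d ≤ length xs) deg-i≡top
                      (count+2≤length (R (vertex i)) xs (∈-lookup i) (∈-lookup a)
                        (i≢a ∘ lookup-injective xs xs! i a) (R-irrefl (vertex i)) a≁i))
      where
        a≁i : R (vertex i) (vertex a) ≡ false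
        a≁i = trans (R-sym (vertex i) (vertex a)) (count≡0 (R (vertex a)) xs deg-a≡0 (∈-lookup i))
    misses-an-end : (∀ i → deg i ≢ 0) ⊎ (∀ i → deg i ≢ suc (length zs))
    misses-an-end with any? (λ i → deg i ℕ.≟ 0)
    ... | yes (a , deg-a≡0) = inj₂ (no-full a deg-a≡0)
    ... | no no-isolated    = inj₁ (λ i deg-i≡0 → no-isolated (i , deg-i≡0))
    as-vertices : (∃₂ λ i j → i ≢ j × deg i ≡ deg j) →
                  ∃₂ λ x y → x ∈ xs × y ∈ xs × x ≢ y × count (R x) xs ≡ count (R y) xs
    as-vertices (i , j , i≢j , same) =
      vertex i , vertex j , ∈-lookup i , ∈-lookup j , i≢j ∘ lookup-injective xs xs! i j , same

module Walks {n : ℕ} (G : SimpleGraph n) where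
  open SimpleGraph G

  reach-zero : ∀ u v → reach G 0 u v ≡ true → u ≡ v
  reach-zero u v r with u ≟ v
  ... | yes u≡v = u≡v

  reach-refl : ∀ v → reach G 0 v v ≡ true
  reach-refl v = dec-true (v ≟ v) refl

  reach-suc : ∀ k u v → reach G k u v ≡ true → reach G (suc k) u v ≡ true
  reach-suc k u v r rewrite r = refl

  reach-suc-false : ∀ k u v → reach G (suc k) u v ≡ false → reach G k u v ≡ false
  reach-suc-false k u v r with reach G k u v
  reach-suc-false k u v () | true
  ... | false = refl

  reach-cons : ∀ k {u w v} → adj u w ≡ true → reach G k w v ≡ true → reach G (suc k) u v ≡ true
  reach-cons k {u} {w} {v} u~w r =
    trans (cong (reach G k u v ∨_) (any-intro _ (∈-allFin w) (cong₂ _∧_ u~w r))) (∨-zeroʳ _)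

  reach-suc-inv : ∀ k u v → reach G (suc k) u v ≡ true →
                  reach G k u v ≡ true ⊎ ∃ λ w → adj u w ≡ true × reach G k w v ≡ true
  reach-suc-inv k u v r with reach G k u v
  ... | true  = inj₁ refl
  ... | false with w , _ , step ← any-witness _ (allFin n) r = inj₂ (w , ∧-true step)

  reach-suc-mono : ∀ j k v → (∀ w → reach G j w v ≡ true → reach G k w v ≡ true) →
                   ∀ u → reach G (suc j) u v ≡ true → reach G (suc k) u v ≡ true
  reach-suc-mono j k v shorten u r =
    [ reach-suc k u v ∘ shorten u , (λ { (w , u~w , w⇝v) → reach-cons k u~w (shorten w w⇝v) }) ]′
      (reach-suc-inv j u v r)

  reach-one : ∀ u v → u ≢ v → reach G 1 u v ≡ adj u v
  reach-one u v u≢v with adj u v in u~v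
  ... | true  = reach-cons 0 u~v (reach-refl v)
  ... | false with reach G 1 u v in r
  ...   | false = refl
  ...   | true with reach-suc-inv 0 u v r
  ...     | inj₁ r₀             = ⊥-elim (u≢v (reach-zero u v r₀))
  ...     | inj₂ (w , u~w , r₀) with refl ← reach-zero w v r₀ with () ← trans (sym u~w) u~v

  isolated-reach : ∀ {x} → (∀ y → adj x y ≡ false) → ∀ k y → reach G k x y ≡ true → x ≡ y
  isolated-reach x≁ zero    y r = reach-zero _ y r
  isolated-reach x≁ (suc k) y r with reach-suc-inv k _ y r
  ... | inj₁ r′            = isolated-reach x≁ k y r′
  ... | inj₂ (w , x~w , _) with () ← trans (sym x~w) (x≁ w)

empty-not-resolving : ∀ {m} (G : SimpleGraph (2 + m)) W → elems G W ≡ [] → ¬ MResolving G W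
empty-not-resolving G W W≡∅ resolving =
  resolving 0F 1F (λ ()) (↭-reflexive (trans (cong (map (dist G 0F)) W≡∅) (sym (cong (map (dist G 1F)) W≡∅))))

singleton-not-resolving : ∀ {n} (G : SimpleGraph n) W w → elems G W ≡ w ∷ [] →
                          ∀ u v → u ≢ v → dist G u w ≡ dist G v w → ¬ MResolving G W
singleton-not-resolving G W w W≡w u v u≢v same resolving = resolving u v u≢v (↭-reflexive (begin
  map (dist G u) (elems G W) ≡⟨ cong (map (dist G u)) W≡w ⟩
  dist G u w ∷ []            ≡⟨ cong (_∷ []) same ⟩
  dist G v w ∷ []            ≡⟨ cong (map (dist G v)) W≡w ⟨
  map (dist G v) (elems G W) ∎))
  where open ≡-Reasoning

-- With diameter ≤ 2 and at least four vertices, some two vertices are equidistant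
-- from w, by pigeonhole on the distances 0, 1, 2.
equidistant-pair : ∀ {m} (G : SimpleGraph (4 + m)) → DiamAtMost2 G →
                   ∀ w → ∃₂ λ u v → u ≢ v × dist G u w ≡ dist G v w
equidistant-pair G diam≤2 w
  with u , v , u<v , same ← pigeonhole (s≤s (s≤s (s≤s (s≤s z≤n)))) (λ x → fromℕ< (s≤s (diam≤2 x w))) =
  u , v , <⇒≢ᶠ u<v , fromℕ<-injective _ _ (s≤s (diam≤2 u w)) (s≤s (diam≤2 v w)) same

-- dist G a b is the least k with a walk of length ≤ k; on at least three
-- vertices the search runs through k = 0, 1, 2, 3, which we spell out.
module _ {m : ℕ} (G : SimpleGraph (3 + m)) (a b : Fin (3 + m)) where
  open Walks G

  dist≡0 : reach G 0 a b ≡ true → dist G a b ≡ 0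
  dist≡0 r₀ rewrite r₀ = refl

  dist≡1 : reach G 0 a b ≡ false → reach G 1 a b ≡ true → dist G a b ≡ 1
  dist≡1 r₀ r₁ rewrite r₀ | r₁ = refl

  dist≡2 : reach G 1 a b ≡ false → reach G 2 a b ≡ true → dist G a b ≡ 2
  dist≡2 r₁ = unfold (reach-suc-false 0 a b r₁) r₁
    where
      unfold : reach G 0 a b ≡ false → reach G 1 a b ≡ false → reach G 2 a b ≡ true → dist G a b ≡ 2
      unfold r₀ r₁ r₂ rewrite r₀ | r₁ | r₂ = refl

dist≡3 : ∀ {m} (G : SimpleGraph (3 + m)) a b → reach G 2 a b ≡ false → reach G 3 a b ≡ true → dist G a b ≡ 3
dist≡3 {m} G a b r₂ = unfold m G a b r₀ r₁ r₂
  where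
    open Walks G
    r₁ = reach-suc-false 1 a b r₂
    r₀ = reach-suc-false 0 a b r₁
    -- with exactly three vertices the search stops at k = 3 without testing it
    unfold : ∀ m′ (H : SimpleGraph (3 + m′)) x y → reach H 0 x y ≡ false → reach H 1 x y ≡ false →
             reach H 2 x y ≡ false → reach H 3 x y ≡ true → dist H x y ≡ 3
    unfold zero    H x y r₀ r₁ r₂ r₃ rewrite r₀ | r₁ | r₂ = refl
    unfold (suc _) H x y r₀ r₁ r₂ r₃ rewrite r₀ | r₁ | r₂ | r₃ = refl

module DiameterTwo {m : ℕ} (G : SimpleGraph (3 + m)) (connected : Connected G) (diam≤2 : DiamAtMost2 G) where
  open SimpleGraph G
  open Walks G

  -- A walk of length ≤ 3 can be shortened to length ≤ 2, else the distance would be 3.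
  shortcut : ∀ a b → reach G 3 a b ≡ true → reach G 2 a b ≡ true
  shortcut a b r₃ with reach G 2 a b Bool.≟ true
  ... | yes r₂ = r₂
  ... | no ¬r₂ = ⊥-elim (1+n≰n (subst (_≤ 2) (dist≡3 G a b (¬-not ¬r₂) r₃) (diam≤2 a b)))

  shorten : ∀ k a b → reach G k a b ≡ true → reach G 2 a b ≡ true
  shorten zero    a b r = reach-suc 1 a b (reach-suc 0 a b r)
  shorten (suc k) a b r = shortcut a b (reach-suc-mono k 2 b (λ w → shorten k w b) a r)

  reach-two : ∀ a b → reach G 2 a b ≡ true
  reach-two a b with k , r ← connected a b = shorten k a b r

  dist-self : ∀ u → dist G u u ≡ 0
  dist-self u = dist≡0 G u u (reach-refl u)

  dist-distinct : ∀ u v → u ≢ v → dist G u v ≡ (if adj u v then 1 else 2)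
  dist-distinct u v u≢v = by-edge (adj u v) refl
    where
      by-edge : ∀ b → adj u v ≡ b → dist G u v ≡ (if b then 1 else 2)
      by-edge true  u~v = dist≡1 G u v (dec-false (u ≟ v) u≢v) (trans (reach-one u v u≢v) u~v)
      by-edge false u≁v = dist≡2 G u v (trans (reach-one u v u≢v) u≁v) (reach-two u v)

  dist≡0-iff-equal : ∀ u x → (dist G u x ≡ᵇ 0) ≡ does (u ≟ x)
  dist≡0-iff-equal u x = by-equality (u ≟ x)
    where
      by-equality : Dec (u ≡ x) → (dist G u x ≡ᵇ 0) ≡ does (u ≟ x)
      by-equality (yes refl) = trans (cong (_≡ᵇ 0) (dist-self u)) (sym (dec-true (u ≟ u) refl))
      by-equality (no u≢x)   = trans (cong (_≡ᵇ 0) (dist-distinct u x u≢x))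
                                 (trans (one-or-two (adj u x)) (sym (dec-false (u ≟ x) u≢x)))
        where
          one-or-two : ∀ b → ((if b then 1 else 2) ≡ᵇ 0) ≡ false
          one-or-two true  = refl
          one-or-two false = refl

  dist≡1-iff-adjacent : ∀ u x → (dist G u x ≡ᵇ 1) ≡ adj u x
  dist≡1-iff-adjacent u x = by-equality (u ≟ x)
    where
      by-equality : Dec (u ≡ x) → (dist G u x ≡ᵇ 1) ≡ adj u x
      by-equality (yes refl) = trans (cong (_≡ᵇ 1) (dist-self u)) (sym (irrefl u))
      by-equality (no u≢x)   = trans (cong (_≡ᵇ 1) (dist-distinct u x u≢x)) (one-iff (adj u x))
        where
          one-iff : ∀ b → ((if b then 1 else 2) ≡ᵇ 1) ≡ b
          one-iff true  = refl
          one-iff false = refl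

  same-rm : ∀ W u v → let L = elems G W in
            count (λ x → does (u ≟ x)) L ≡ count (λ x → does (v ≟ x)) L →
            count (adj u) L ≡ count (adj v) L → rm G u W ↭ rm G v W
  same-rm W u v same-membership same-degree =
    ↭-by-occurrences (rm G u W) (rm G v W) (bounded u) (bounded v)
      (trans (length-map (dist G u) L) (sym (length-map (dist G v) L)))
      (trans (zeros u) (trans same-membership (sym (zeros v))))
      (trans (ones u) (trans same-degree (sym (ones v))))
    where
      L = elems G W
      bounded : ∀ u → All (_≤ 2) (rm G u W)
      bounded u = map⁺ (universal (diam≤2 u) L)
      zeros : ∀ u → occ 0 (rm G u W) ≡ count (λ x → does (u ≟ x)) L
      zeros u = trans (count-map (_≡ᵇ 0) (dist G u) L) (count-cong (dist≡0-iff-equal u) L)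
      ones : ∀ u → occ 1 (rm G u W) ≡ count (adj u) L
      ones u = trans (count-map (_≡ᵇ 1) (dist G u) L) (count-cong (dist≡1-iff-adjacent u) L)

  elems-unique : ∀ W → Unique (elems G W)
  elems-unique W = filter⁺ (λ x → T? (Vec.lookup W x)) (allFin⁺ (3 + m))

  large-not-resolving : ∀ W → 2 ≤ length (elems G W) → ¬ MResolving G W
  large-not-resolving W |W|≥2 resolving
    with x , y , x∈W , y∈W , x≢y , same-degree ← equal-degrees adj symm irrefl (elems G W) (elems-unique W) |W|≥2 =
    resolving x y x≢y (same-rm W x y
      (trans (count-member _≟_ x (elems G W) (elems-unique W) x∈W)
        (sym (count-member _≟_ y (elems G W) (elems-unique W) y∈W)))
      same-degree)

  no-m-resolving-set : (∀ w → ∃₂ λ u v → u ≢ v × dist G u w ≡ dist G v w) → MdInfinite G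
  no-m-resolving-set equidistant W = by-size (elems G W) refl
    where
      by-size : ∀ xs → elems G W ≡ xs → ¬ MResolving G W
      by-size []          W≡∅ = empty-not-resolving G W W≡∅
      by-size (w ∷ [])    W≡w with u , v , u≢v , same ← equidistant w =
        singleton-not-resolving G W w W≡w u v u≢v same
      by-size (_ ∷ _ ∷ _) W≡xs = large-not-resolving W (subst (λ xs → 2 ≤ length xs) (sym W≡xs) (s≤s (s≤s z≤n)))

consecutive : ∀ {n} → Fin n → Fin n → Bool
consecutive i j = (toℕ i ≡ᵇ suc (toℕ j)) ∨ (toℕ j ≡ᵇ suc (toℕ i))

consecutive-true : ∀ {n} (i j : Fin n) →
                   consecutive i j ≡ true ⇔ (toℕ i ≡ suc (toℕ j) ⊎ toℕ j ≡ suc (toℕ i))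
consecutive-true i j = mk⇔
  (Sum.map (≡ᵇ⇒≡ _ _) (≡ᵇ⇒≡ _ _) ∘ to T-∨ ∘ from T-≡)
  (to T-≡ ∘ from T-∨ ∘ Sum.map (≡⇒≡ᵇ _ _) (≡⇒≡ᵇ _ _))

path-by-labelling : ∀ {n} (G : SimpleGraph n) (π : Permutation′ n) →
                    (∀ u v → SimpleGraph.adj G u v ≡ consecutive (π ⟨$⟩ʳ u) (π ⟨$⟩ʳ v)) → IsPath G
path-by-labelling G π adj≡ =
  (π ⟨$⟩ʳ_) , Bijection.bijective (Inverse⇒Bijection π) ,
  λ u v → mk⇔ (to (consecutive-true _ _) ∘ trans (sym (adj≡ u v))) (trans (adj≡ u v) ∘ from (consecutive-true _ _))

path₀ : (G : SimpleGraph 0) → IsPath G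
path₀ G = path-by-labelling G Perm.id (λ ())

path₁ : (G : SimpleGraph 1) → IsPath G
path₁ G = path-by-labelling G Perm.id (λ { 0F 0F → SimpleGraph.irrefl G 0F })

path₂ : (G : SimpleGraph 2) → Connected G → IsPath G
path₂ G connected = path-by-labelling G Perm.id
  (λ { 0F 0F → irrefl 0F ; 0F 1F → edge ; 1F 0F → trans (symm 1F 0F) edge ; 1F 1F → irrefl 1F })
  where
    open SimpleGraph G
    open Walks G
    -- otherwise vertex 0 would have no neighbour and could not reach vertex 1
    edge : adj 0F 1F ≡ true
    edge with adj 0F 1F in 0≁1
    ... | true  = refl
    ... | false with k , r ← connected 0F 1F
                with () ← isolated-reach (λ { 0F → irrefl 0F ; 1F → 0≁1 }) k 1F r

table₃ : Bool → Bool → Bool → Fin 3 → Fin 3 → Bool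
table₃ a b c 0F 1F = a
table₃ a b c 1F 0F = a
table₃ a b c 0F 2F = b
table₃ a b c 2F 0F = b
table₃ a b c 1F 2F = c
table₃ a b c 2F 1F = c
table₃ a b c _  _  = false

by-evaluation : ∀ {k} (f g : Fin k → Fin k → Bool) →
                {True (all? λ u → all? λ v → f u v Bool.≟ g u v)} → ∀ u v → f u v ≡ g u v
by-evaluation f g {checked} = toWitness checked

module ThreeVertices (G : SimpleGraph 3) (connected : Connected G) where
  open SimpleGraph G
  open Walks G

  edges : ∀ u v → adj u v ≡ table₃ (adj 0F 1F) (adj 0F 2F) (adj 1F 2F) u v
  edges 0F 0F = irrefl 0F
  edges 0F 1F = refl
  edges 0F 2F = refl
  edges 1F 0F = symm 1F 0F
  edges 1F 1F = irrefl 1F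
  edges 1F 2F = refl
  edges 2F 0F = symm 2F 0F
  edges 2F 1F = symm 2F 1F
  edges 2F 2F = irrefl 2F

  not-isolated : ∀ x y → x ≢ y → ¬ (∀ z → adj x z ≡ false)
  not-isolated x y x≢y x≁ with k , r ← connected x y = x≢y (isolated-reach x≁ k y r)

  -- A connected graph on three vertices with at most one edge is impossible,
  -- with two edges it is a path, so if it is not a path it is a triangle.
  path-or-triangle : ¬ IsPath G → ∀ u v → u ≢ v → adj u v ≡ true
  path-or-triangle not-path = by-edges (adj 0F 1F) (adj 0F 2F) (adj 1F 2F) edges
    where
      path : (π : Permutation′ 3) → ∀ {a b c} → (∀ u v → adj u v ≡ table₃ a b c u v) →
             (∀ u v → table₃ a b c u v ≡ consecutive (π ⟨$⟩ʳ u) (π ⟨$⟩ʳ v)) → ⊥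
      path π adj≡ labelled = not-path (path-by-labelling G π (λ u v → trans (adj≡ u v) (labelled u v)))
      lonely : ∀ {a b c} → (∀ u v → adj u v ≡ table₃ a b c u v) →
               ∀ x y → x ≢ y → (∀ z → table₃ a b c x z ≡ false) → ⊥
      lonely adj≡ x y x≢y row = not-isolated x y x≢y (λ z → trans (adj≡ x z) (row z))
      by-edges : ∀ a b c → (∀ u v → adj u v ≡ table₃ a b c u v) → ∀ u v → u ≢ v → adj u v ≡ true
      by-edges true  true  true  adj≡ u v u≢v =
        trans (adj≡ u v) (trans (by-evaluation (table₃ true true true) (λ u v → Bool.not (does (u ≟ v))) u v)
                                (cong Bool.not (dec-false (u ≟ v) u≢v)))
      -- two edges: a path whose middle vertex is 1, 0 or 2
      by-edges true  false true  adj≡ = ⊥-elim (path Perm.id adj≡ (by-evaluation _ _))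
      by-edges true  true  false adj≡ = ⊥-elim (path (transpose 0F 1F) adj≡ (by-evaluation _ _))
      by-edges false true  true  adj≡ = ⊥-elim (path (transpose 1F 2F) adj≡ (by-evaluation _ _))
      -- at most one edge: some vertex has no neighbour
      by-edges false false c     adj≡ = ⊥-elim (lonely adj≡ 0F 1F (λ ()) λ { 0F → refl ; 1F → refl ; 2F → refl })
      by-edges true  false false adj≡ = ⊥-elim (lonely adj≡ 2F 0F (λ ()) λ { 0F → refl ; 1F → refl ; 2F → refl })
      by-edges false true  false adj≡ = ⊥-elim (lonely adj≡ 1F 0F (λ ()) λ { 0F → refl ; 1F → refl ; 2F → refl })

triangle-equidistant : (G : SimpleGraph 3) → Connected G → DiamAtMost2 G →
                       (∀ u v → u ≢ v → SimpleGraph.adj G u v ≡ true) →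
                       ∀ w → ∃₂ λ u v → u ≢ v × dist G u w ≡ dist G v w
triangle-equidistant G connected diam≤2 complete = λ
  { 0F → pair 1F 2F (λ ()) (λ ()) (λ ())
  ; 1F → pair 0F 2F (λ ()) (λ ()) (λ ())
  ; 2F → pair 0F 1F (λ ()) (λ ()) (λ ()) }
  where
    open DiameterTwo G connected diam≤2
    at-one : ∀ u w → u ≢ w → dist G u w ≡ 1
    at-one u w u≢w = trans (dist-distinct u w u≢w) (cong (if_then 1 else 2) (complete u w u≢w))
    pair : ∀ u v {w} → u ≢ v → u ≢ w → v ≢ w → ∃₂ λ x y → x ≢ y × dist G x w ≡ dist G y w
    pair u v {w} u≢v u≢w v≢w = u , v , u≢v , trans (at-one u w u≢w) (sym (at-one v w v≢w))

theorem3p2 : (n : ℕ) (G : SimpleGraph n) → Connected G → DiamAtMost2 G →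
    ¬ IsPath G → MdInfinite G
theorem3p2 0 G _ _ not-path = ⊥-elim (not-path (path₀ G))
theorem3p2 1 G _ _ not-path = ⊥-elim (not-path (path₁ G))
theorem3p2 2 G connected _ not-path = ⊥-elim (not-path (path₂ G connected))
theorem3p2 3 G connected diam≤2 not-path =
  DiameterTwo.no-m-resolving-set G connected diam≤2
    (triangle-equidistant G connected diam≤2 (ThreeVertices.path-or-triangle G connected not-path))
theorem3p2 (suc (suc (suc (suc m)))) G connected diam≤2 not-path =
  DiameterTwo.no-m-resolving-set G connected diam≤2 (equidistant-pair G diam≤2)
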